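{- Let $G$ be a mixed graph on a finite vertex set with $n \geq 2$ vertices, with $E_1$ its set of non-edges, $E_2$ its set of non-oriented edges, $E_3$ its set of oriented edges, and $\overline{E_3}$ the set $E_3$ with all orientations reversed; assume $E_1\cup E_2\neq\emptyset$. Let $e \in E_1\cup E_2$ and $A = (E_1\cup E_2)\setminus\{e\}$. Let $N_A$ be the number of permutations $\mathbf{x}$ of $G$ with $A\subseteq E(\mathbf{x})$ and $E(\mathbf{x})\cap\overline{E_3}=\emptyset$, and let $N_{=A}$ be the number of permutations $\mathbf{x}$ of $G$ with $E(\mathbf{x})\cap(E_1\cup E_2) = A$ and $E(\mathbf{x})\cap\overline{E_3}=\emptyset$. Then $N_A$ and $N_{=A}$ have the same parity; hence the number of permutations of $G$ containing all elements of $E_1\cup E_2$ and no element of $\overline{E_3}$ is even.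
   Context: A mixed graph $G$ on a finite vertex set $V$: each unordered pair of distinct vertices is exactly one of: a non-edge (the set of these is $E_1$), a non-oriented edge (the set of these is $E_2$), or an oriented edge in one of the two possible directions (the set of these ordered pairs is $E_3$). $\overline{E_3}=\{(y,x) : (x,y)\in E_3\}$. A permutation of $G$ is an ordering $\mathbf{x}=(x_1,\dots,x_n)$ of all vertices of $G$. For $1\le i\le n-1$, the neighboring pair of $x_i,x_{i+1}$ is the unordered pair $\{x_i,x_{i+1}\}$ if this pair lies in $E_1\cup E_2$, and otherwise it is the ordered pair $(x_i,x_{i+1})$, which then lies in $E_3$ or in $\overline{E_3}$. $E(\mathbf{x})$ denotes the set of the $n-1$ neighboring pairs of $\mathbf{x}$, and $\mathbf{x}$ contains $e$ if $e\in E(\mathbf{x})$. -}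

module Defs where

open import Data.Nat using (ℕ; zero; suc)
open import Data.Fin using (Fin; _≟_)
open import Data.Bool using (Bool; true; false; _∧_; _∨_; not; T; T?)
open import Data.Bool.ListAction using (any; all)
open import Data.List using (List; []; _∷_; [_]; map; concatMap; allFin; filter; length)
open import Data.Product using (_×_; _,_)
open import Relation.Nullary.Decidable using (⌊_⌋)
open import Relation.Binary.PropositionalEquality using (_≡_; _≢_)
open import Relation.Unary using (Pred)
open import Level using (0ℓ)

-- Type of an unordered pair {i,j}, seen from i:
--   non   : {i,j} ∈ E₁ (non-edge)
--   undir : {i,j} ∈ E₂ (non-oriented edge)
--   out   : (i,j) ∈ E₃ (oriented edge i → j)
--   inn   : (j,i) ∈ E₃ (oriented edge j → i), i.e. (i,j) ∈ reverse(E₃)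
data Kind : Set where
  non undir out inn : Kind

flipK : Kind → Kind
flipK non   = non
flipK undir = undir
flipK out   = inn
flipK inn   = out

-- A mixed graph on vertex set Fin n.  The value on the diagonal is irrelevant.
record MixedGraph (n : ℕ) : Set where
  field
    kind : Fin n → Fin n → Kind
    kind-sym : ∀ i j → i ≢ j → kind j i ≡ flipK (kind i j)
open MixedGraph public

inE12 : Kind → Bool
inE12 non   = true
inE12 undir = true
inE12 out   = false
inE12 inn   = false

inE3bar : Kind → Bool
inE3bar inn = true
inE3bar _   = false

_==_ : ∀ {n} → Fin n → Fin n → Bool
u == v = ⌊ u ≟ v ⌋

neighbours : ∀ {A : Set} → List A → List (A × A)
neighbours []           = []
neighbours (x ∷ [])     = []
neighbours (x ∷ y ∷ xs) = (x , y) ∷ neighbours (y ∷ xs)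

distinct : ∀ {n} → List (Fin n) → Bool
distinct []       = true
distinct (x ∷ xs) = not (any (x ==_) xs) ∧ distinct xs

words : ∀ {n} → ℕ → List (List (Fin n))
words zero    = [ [] ]
words {n} (suc k) = concatMap (λ v → map (v ∷_) (words k)) (allFin n)

-- permutations of the vertex set Fin n: orderings x = (x_1,…,x_n) of all vertices
permutations : (n : ℕ) → List (List (Fin n))
permutations n = filter (λ xs → T? (distinct xs)) (words n)

countPerms : (n : ℕ) → (List (Fin n) → Bool) → ℕ
countPerms n P = length (filter (λ xs → T? (P xs)) (permutations n))

-- the unordered pair {u,v} is a neighbouring pair of x (i.e. {u,v} ∈ E(x))
contains : ∀ {n} → List (Fin n) → Fin n → Fin n → Bool
contains x u v = any (λ { (p , q) → (p == u ∧ q == v) ∨ (p == v ∧ q == u) }) (neighbours x)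

avoidsE3bar : ∀ {n} → MixedGraph n → List (Fin n) → Bool
avoidsE3bar G x = all (λ { (p , q) → not (inE3bar (kind G p q)) }) (neighbours x)

samePair : ∀ {n} → Fin n → Fin n → Fin n → Fin n → Bool
samePair u v a b = (u == a ∧ v == b) ∨ (u == b ∧ v == a)

forallE12 : ∀ {n} → MixedGraph n → (Fin n → Fin n → Bool) → Bool
forallE12 {n} G P =
  all (λ u → all (λ v → not (not (u == v) ∧ inE12 (kind G u v)) ∨ P u v) (allFin n)) (allFin n)

containsA : ∀ {n} → MixedGraph n → Fin n → Fin n → List (Fin n) → Bool
containsA G a b x = forallE12 G (λ u v → samePair u v a b ∨ contains x u v)

exactlyA : ∀ {n} → MixedGraph n → Fin n → Fin n → List (Fin n) → Bool
exactlyA G a b x =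
  forallE12 G (λ u v → (contains x u v ∧ not (samePair u v a b))
                       ∨ (not (contains x u v) ∧ samePair u v a b))

containsE12 : ∀ {n} → MixedGraph n → List (Fin n) → Bool
containsE12 G x = forallE12 G (λ u v → contains x u v)

N-A : ∀ {n} → MixedGraph n → Fin n → Fin n → ℕ
N-A {n} G a b = countPerms n (λ x → containsA G a b x ∧ avoidsE3bar G x)

N-=A : ∀ {n} → MixedGraph n → Fin n → Fin n → ℕ
N-=A {n} G a b = countPerms n (λ x → exactlyA G a b x ∧ avoidsE3bar G x)

N-all : ∀ {n} → MixedGraph n → ℕ
N-all {n} G = countPerms n (λ x → containsE12 G x ∧ avoidsE3bar G x)

module Submission where

-- N-A counts the permutations counted by N-=A together with those counted by N-all, so it suffices that
-- N-all is even. Orienting a pair {a,b} of E₁ ∪ E₂ as a → b (resp. b → a) forbids the step (b,a) (resp. (a,b)).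
-- A permutation through {a,b} uses it in one direction only and survives exactly one orientation, one not
-- through {a,b} survives both; hence N-all(G) ≡ N-all(G_{a→b}) + N-all(G_{b→a}) (mod 2), and orienting the
-- pairs one at a time leaves a graph whose only pair in E₁ ∪ E₂ is {a,b}. There the permutations avoiding Ē₃
-- are those through {a,b}, counted by N-all, and the Hamiltonian paths along E₃. By Berge's segmentation
-- argument for Rédei's theorem, the permutations with every step in a relation w are, mod 2, as many as those
-- with no step in w. For w = E₃, after reversing the permutations, this says that the Hamiltonian paths along
-- E₃ have the parity of all permutations avoiding Ē₃, so N-all is even.

open import Defs
open import Data.Nat using (ℕ; zero; suc; _+_; _*_; _≤_; _<_; s≤s; _%_; parity)
open import Data.Nat.Properties using (+-suc; +-comm)
open import Data.Nat.DivMod using ([m+kn]%n≡m%n)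
open import Data.Nat.Induction using (<-wellFounded)
open import Data.Nat.Divisibility using (_∣_; divides)
open import Data.Parity.Base as ℙ using (0ℙ)
import Data.Parity.Properties as ℙ
open import Data.Bool using (Bool; true; false; T; T?; _∧_; _∨_; not; if_then_else_)
open import Data.Bool.Properties
  using (T-≡; T-∧; T-∨; ∧-assoc; ∧-comm; ∧-identityʳ; ∧-zeroʳ; ∨-comm; ∨-zeroʳ; ∨-identityʳ
        ; ∧-commutativeMonoid; ∨-commutativeMonoid)
open import Algebra.Bundles using (CommutativeMonoid)
open import Data.Bool.ListAction using (and; any; all)
open import Data.Fin using (Fin; _≟_)
open import Data.Fin.Properties using (any?)
open import Data.List
  using ( List; []; _∷_; [_]; _++_; length; map; filter; concat; concatMap; allFin; cartesianProduct
        ; reverse; reverseAcc)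
open import Data.List.Properties
  using ( length-++; length-map; length-filter; filter-++; filter-all; filter-none; map-cong; ++-assoc; ++-identityʳ
        ; ∷-injective; ∷-injectiveˡ; ∷-injectiveʳ; reverse-injective; reverse-involutive; ≡-dec)
open import Data.List.Membership.Propositional using (_∈_; _∉_; lose; find)
open import Data.List.Membership.Propositional.Properties
  using ( ∈-filter⁺; ∈-filter⁻; ∈-map⁺; ∈-map⁻; ∈-concatMap⁺; ∈-concatMap⁻; ∈-allFin; ∈-cartesianProduct⁺
        ; ∈-++⁻; ∈-++⁺ˡ; ∈-++⁺ʳ)
open import Data.List.Relation.Unary.Any as Any using (Any; here; there)
open import Data.List.Relation.Unary.Any.Properties using (any⁺; any⁻)
open import Data.List.Relation.Unary.All as All using (All; []; _∷_)
open import Data.List.Relation.Unary.All.Properties as All using (All¬⇒¬Any; all⁺; all⁻)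
open import Data.List.Relation.Unary.AllPairs as AllPairs using ([]; _∷_)
import Data.List.Relation.Unary.AllPairs.Properties as AllPairs
open import Data.List.Relation.Unary.Unique.Propositional using (Unique)
open import Data.List.Relation.Binary.Permutation.Propositional using (_↭_; ↭-sym; ↭⇒↭ₛ)
open import Data.List.Relation.Binary.Permutation.Propositional.Properties
  using (↭-length; ↭-reverse; filter-↭; ++⁺ʳ) renaming (++-comm to ↭-++-comm)
open import Data.List.Relation.Binary.BagAndSetEquality using (∼bag⇒↭)
open import Data.List.Membership.Propositional.Properties.WithK using (unique∧set⇒bag)
import Data.List.Relation.Unary.Unique.Propositional.Properties as Unique
open import Data.Product using (_×_; _,_; proj₁; proj₂; uncurry; ∃; ∃₂)
open import Data.Unit using (tt)
open import Data.Empty using (⊥; ⊥-elim)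
open import Data.Sum using (_⊎_; inj₁; inj₂)
open import Function using (_∘_; flip; mk⇔; Equivalence)
open import Induction.WellFounded using (Acc; acc)
open import Relation.Binary.Definitions using (DecidableEquality)
open import Relation.Binary.PropositionalEquality hiding ([_])
open import Relation.Nullary using (¬_; Dec; yes; no)
open import Relation.Nullary.Decidable using (¬?; _×-dec_; toWitness; fromWitness)
open import Relation.Nullary.Negation using (contradiction)

module _ {A : Set} where

  count : (A → Bool) → List A → ℕ
  count P xs = length (filter (λ x → T? (P x)) xs)

  count-++ : ∀ (P : A → Bool) xs ys → count P (xs ++ ys) ≡ count P xs + count P ys
  count-++ P xs ys = trans (cong length (filter-++ _ xs ys)) (length-++ (filter _ xs))

  count-∷ : ∀ (P : A → Bool) x xs → count P (x ∷ xs) ≡ (if P x then 1 else 0) + count P xs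
  count-∷ P x xs with P x
  ... | true  = refl
  ... | false = refl

  count-cong : ∀ {P Q : A → Bool} xs → (∀ {x} → x ∈ xs → P x ≡ Q x) → count P xs ≡ count Q xs
  count-cong             []       eq = refl
  count-cong {P} {Q} (x ∷ xs) eq with P x | Q x | eq {x} (here refl)
  ... | true  | _ | refl = cong suc (count-cong xs (eq ∘ there))
  ... | false | _ | refl = count-cong xs (eq ∘ there)

  count-split : ∀ (P Q : A → Bool) xs →
    count P xs ≡ count (λ x → P x ∧ Q x) xs + count (λ x → P x ∧ not (Q x)) xs
  count-split P Q []       = refl
  count-split P Q (x ∷ xs) with P x | Q x
  ... | false | _     = count-split P Q xs
  ... | true  | true  = cong suc (count-split P Q xs)
  ... | true  | false = trans (cong suc (count-split P Q xs)) (sym (+-suc _ _))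

  count-↭ : ∀ (P : A → Bool) {xs ys} → xs ↭ ys → count P xs ≡ count P ys
  count-↭ P xs↭ys = ↭-length (filter-↭ _ xs↭ys)

  count-false : ∀ xs → count (λ _ → false) xs ≡ 0
  count-false xs = cong length (filter-none _ (All.universal (λ _ ()) xs))

  count-true : ∀ xs → count (λ _ → true) xs ≡ length xs
  count-true xs = cong length (filter-all _ (All.universal _ xs))

  length-split : ∀ (Q : A → Bool) xs → length xs ≡ count Q xs + count (not ∘ Q) xs
  length-split Q xs = trans (sym (count-true xs)) (count-split (λ _ → true) Q xs)

  parity-count-additive : ∀ {P Q R : A → Bool} xs →
    (∀ {x} → x ∈ xs →
       parity (if P x then 1 else 0) ≡ parity (if Q x then 1 else 0) ℙ.+ parity (if R x then 1 else 0)) →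
    parity (count P xs) ≡ parity (count Q xs) ℙ.+ parity (count R xs)
  parity-count-additive             []       eq = refl
  parity-count-additive {P} {Q} {R} (x ∷ xs) eq = begin
    parity (count P (x ∷ xs))
      ≡⟨ cong parity (count-∷ P x xs) ⟩
    parity ((if P x then 1 else 0) + count P xs)
      ≡⟨ ℙ.+-homo-+ (if P x then 1 else 0) _ ⟩
    parity (if P x then 1 else 0) ℙ.+ parity (count P xs)
      ≡⟨ cong₂ ℙ._+_ (eq (here refl)) (parity-count-additive xs (eq ∘ there)) ⟩
    (q ℙ.+ r) ℙ.+ (parity (count Q xs) ℙ.+ parity (count R xs))
      ≡⟨ interchange q r _ _ ⟩
    (q ℙ.+ parity (count Q xs)) ℙ.+ (r ℙ.+ parity (count R xs))
      ≡⟨ sym (cong₂ ℙ._+_ (ℙ.+-homo-+ (if Q x then 1 else 0) _) (ℙ.+-homo-+ (if R x then 1 else 0) _)) ⟩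
    parity ((if Q x then 1 else 0) + count Q xs) ℙ.+ parity ((if R x then 1 else 0) + count R xs)
      ≡⟨ sym (cong₂ (λ m n → parity m ℙ.+ parity n) (count-∷ Q x xs) (count-∷ R x xs)) ⟩
    parity (count Q (x ∷ xs)) ℙ.+ parity (count R (x ∷ xs)) ∎
    where
    open ≡-Reasoning
    open import Algebra.Properties.CommutativeSemigroup ℙ.+-commutativeSemigroup using (interchange)
    q = parity (if Q x then 1 else 0)
    r = parity (if R x then 1 else 0)

module _ {A B : Set} where

  count-map : ∀ (P : B → Bool) (f : A → B) xs → count P (map f xs) ≡ count (P ∘ f) xs
  count-map P f []       = refl
  count-map P f (x ∷ xs) with P (f x)
  ... | true  = cong suc (count-map P f xs)
  ... | false = count-map P f xs

  count-concatMap : ∀ {P : A → Bool} {Q : B → Bool} (f : A → List B) xs →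
    (∀ {x} → x ∈ xs → count Q (f x) ≡ (if P x then 1 else 0)) → count Q (concatMap f xs) ≡ count P xs
  count-concatMap         f []       eq = refl
  count-concatMap {P} {Q} f (x ∷ xs) eq = begin
    count Q (f x ++ concatMap f xs)
      ≡⟨ count-++ Q (f x) _ ⟩
    count Q (f x) + count Q (concatMap f xs)
      ≡⟨ cong₂ _+_ (eq (here refl)) (count-concatMap f xs (eq ∘ there)) ⟩
    (if P x then 1 else 0) + count P xs
      ≡⟨ count-∷ P x xs ⟨
    count P (x ∷ xs) ∎
    where open ≡-Reasoning

  parity-length-concatMap : ∀ {P : A → Bool} (f : A → List B) xs →
    (∀ {x} → x ∈ xs → parity (length (f x)) ≡ parity (if P x then 1 else 0)) →
    parity (length (concatMap f xs)) ≡ parity (count P xs)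
  parity-length-concatMap     f []       eq = refl
  parity-length-concatMap {P} f (x ∷ xs) eq = begin
    parity (length (f x ++ concatMap f xs))
      ≡⟨ cong parity (length-++ (f x)) ⟩
    parity (length (f x) + length (concatMap f xs))
      ≡⟨ ℙ.+-homo-+ (length (f x)) _ ⟩
    parity (length (f x)) ℙ.+ parity (length (concatMap f xs))
      ≡⟨ cong₂ ℙ._+_ (eq (here refl)) (parity-length-concatMap f xs (eq ∘ there)) ⟩
    parity (if P x then 1 else 0) ℙ.+ parity (count P xs)
      ≡⟨ ℙ.+-homo-+ (if P x then 1 else 0) _ ⟨
    parity ((if P x then 1 else 0) + count P xs)
      ≡⟨ cong parity (count-∷ P x xs) ⟨
    parity (count P (x ∷ xs)) ∎
    where open ≡-Reasoning

-- Fixed-point-free involutions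

module _ {A : Set} (_≟ᴬ_ : DecidableEquality A) where

  remove : A → List A → List A
  remove y = filter (λ z → ¬? (z ≟ᴬ y))

  length-remove : ∀ {y xs} → Unique xs → y ∈ xs → length xs ≡ suc (length (remove y xs))
  length-remove {y} {x ∷ xs} (x∉xs ∷ _) (here refl) with x ≟ᴬ x
  ... | yes _  = cong suc (cong length (sym (filter-all _ (All.map (λ x≢z z≡x → x≢z (sym z≡x)) x∉xs))))
  ... | no x≢x = contradiction refl x≢x
  length-remove {y} {x ∷ xs} (x∉xs ∷ u) (there y∈xs) with x ≟ᴬ y
  ... | yes refl = contradiction y∈xs (All¬⇒¬Any x∉xs)
  ... | no _     = cong suc (length-remove u y∈xs)

  module _ (φ : A → A) (φ-involutive : ∀ x → φ (φ x) ≡ x) where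

    Closed : List A → Set
    Closed xs = ∀ {x} → x ∈ xs → φ x ∈ xs

    FixedPointFree : List A → Set
    FixedPointFree xs = ∀ {x} → x ∈ xs → φ x ≢ x

    involution-even : ∀ xs → Unique xs → Closed xs → FixedPointFree xs → parity (length xs) ≡ 0ℙ
    involution-even xs = go xs (<-wellFounded (length xs))
      where
      go : ∀ xs → Acc _<_ (length xs) → Unique xs → Closed xs → FixedPointFree xs → parity (length xs) ≡ 0ℙ
      go []       _        _                _      _   = refl
      go (x ∷ xs) (acc rs) (x∉xs ∷ uxs) closed fpf = begin
        parity (suc (length xs))  ≡⟨ cong (parity ∘ suc) (length-remove uxs φx∈xs) ⟩
        parity (length ys)        ≡⟨ go ys (rs (s≤s (length-filter _ xs))) (Unique.filter⁺ _ uxs) ys-closed ys-fpf ⟩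
        0ℙ                        ∎
        where
        open ≡-Reasoning
        ys = remove (φ x) xs
        φx∈xs : φ x ∈ xs
        φx∈xs with closed (here refl)
        ... | here φx≡x = contradiction φx≡x (fpf (here refl))
        ... | there φx∈xs = φx∈xs
        ys-closed : Closed ys
        ys-closed {y} y∈ys with ∈-filter⁻ _ {xs = xs} y∈ys
        ... | y∈xs , y≢φx with closed (there y∈xs)
        ... | here φy≡x = contradiction (trans (sym (φ-involutive y)) (cong φ φy≡x)) y≢φx
        ... | there φy∈xs = ∈-filter⁺ _ φy∈xs λ φy≡φx →
              All¬⇒¬Any x∉xs (subst (_∈ xs) (trans (sym (φ-involutive y)) (trans (cong φ φy≡φx) (φ-involutive x)))
                                         y∈xs)
        ys-fpf : FixedPointFree ys
        ys-fpf y∈ys = fpf (there (proj₁ (∈-filter⁻ _ {xs = xs} y∈ys)))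

module _ {A : Set} where

  any-∨ : ∀ (f g : A → Bool) xs → any (λ x → f x ∨ g x) xs ≡ any f xs ∨ any g xs
  any-∨ f g []       = refl
  any-∨ f g (x ∷ xs) = trans (cong ((f x ∨ g x) ∨_) (any-∨ f g xs)) (∨-interchange (f x) (g x) _ _)
    where
    open import Algebra.Properties.CommutativeSemigroup
      (CommutativeMonoid.commutativeSemigroup ∨-commutativeMonoid)
            renaming (interchange to ∨-interchange)

  all-not-∨ : ∀ (f g : A → Bool) xs → all (λ x → not (f x ∨ g x)) xs ≡ all (λ x → not (f x)) xs ∧ not (any g xs)
  all-not-∨ f g []       = refl
  all-not-∨ f g (x ∷ xs) with f x | g x
  ... | true  | _     = refl
  ... | false | true  = sym (∧-zeroʳ _)
  ... | false | false = all-not-∨ f g xs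

  allSteps : (A → A → Bool) → List A → Bool
  allSteps R xs = all (uncurry R) (neighbours xs)

  allSteps⁻ : ∀ (R : A → A → Bool) xs → T (allSteps R xs) → ∀ {p q} → (p , q) ∈ neighbours xs → T (R p q)
  allSteps⁻ R xs t pq∈ = All.lookup (all⁺ _ (neighbours xs) t) pq∈

  allSteps⁺ : ∀ (R : A → A → Bool) xs → (∀ {p q} → (p , q) ∈ neighbours xs → T (R p q)) → T (allSteps R xs)
  allSteps⁺ R xs h = all⁻ _ (All.tabulate h)

  allSteps-reverseAcc : ∀ (R : A → A → Bool) xs a zs →
    allSteps R (reverseAcc (a ∷ zs) xs) ≡ allSteps (flip R) (a ∷ xs) ∧ allSteps R (a ∷ zs)
  allSteps-reverseAcc R []       a zs = refl
  allSteps-reverseAcc R (x ∷ xs) a zs = begin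
    allSteps R (reverseAcc (x ∷ a ∷ zs) xs)
      ≡⟨ allSteps-reverseAcc R xs x (a ∷ zs) ⟩
    allSteps (flip R) (x ∷ xs) ∧ (R x a ∧ allSteps R (a ∷ zs))
      ≡⟨ ∧-assoc (allSteps (flip R) (x ∷ xs)) _ _ ⟨
    (allSteps (flip R) (x ∷ xs) ∧ R x a) ∧ allSteps R (a ∷ zs)
      ≡⟨ cong (_∧ allSteps R (a ∷ zs)) (∧-comm (allSteps (flip R) (x ∷ xs)) _) ⟩
    allSteps (flip R) (a ∷ x ∷ xs) ∧ allSteps R (a ∷ zs) ∎
    where open ≡-Reasoning

  allSteps-reverse : ∀ (R : A → A → Bool) xs → allSteps R (reverse xs) ≡ allSteps (flip R) xs
  allSteps-reverse R []       = refl
  allSteps-reverse R (x ∷ xs) = trans (allSteps-reverseAcc R xs x []) (∧-identityʳ _)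

  ∈-neighbours⇒∈tail : ∀ {p q x : A} {xs} → (p , q) ∈ neighbours (x ∷ xs) → q ∈ xs
  ∈-neighbours⇒∈tail {xs = _ ∷ _} (here refl)  = here refl
  ∈-neighbours⇒∈tail {xs = _ ∷ _} (there pq∈) = there (∈-neighbours⇒∈tail pq∈)

  ∈-neighbours⇒≢ : ∀ {p q : A} {xs} → Unique xs → (p , q) ∈ neighbours xs → p ≢ q
  ∈-neighbours⇒≢ {xs = x ∷ y ∷ xs} ((x≢y ∷ _) ∷ _) (here refl) = x≢y
  ∈-neighbours⇒≢ {xs = x ∷ y ∷ xs} (_ ∷ u)         (there pq∈) = ∈-neighbours⇒≢ u pq∈

  ∈-neighbours-asym : ∀ {p q : A} {xs} → Unique xs → (p , q) ∈ neighbours xs → (q , p) ∉ neighbours xs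
  ∈-neighbours-asym {xs = x ∷ y ∷ xs} ((x≢y ∷ _) ∷ _) (here refl) (here qp≡pq) = x≢y (cong proj₁ (sym qp≡pq))
  ∈-neighbours-asym {xs = x ∷ y ∷ xs} (x∉ ∷ _)        (here refl) (there yx∈) =
    All¬⇒¬Any x∉ (there (∈-neighbours⇒∈tail yx∈))
  ∈-neighbours-asym {xs = x ∷ y ∷ xs} (x∉ ∷ _)        (there pq∈) (here refl) =
    All¬⇒¬Any x∉ (there (∈-neighbours⇒∈tail pq∈))
  ∈-neighbours-asym {xs = x ∷ y ∷ xs} (_ ∷ u)         (there pq∈) (there qp∈) = ∈-neighbours-asym u pq∈ qp∈

module _ {n : ℕ} where

  open import Data.List.Relation.Binary.Permutation.Setoid.Properties (setoid (Fin n)) using (Unique-resp-↭)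

  ¬any==⇒All≢ : ∀ (x : Fin n) xs → T (not (any (x ==_) xs)) → All (x ≢_) xs
  ¬any==⇒All≢ x []       _ = []
  ¬any==⇒All≢ x (y ∷ xs) t with x ≟ y
  ... | no x≢y = x≢y ∷ ¬any==⇒All≢ x xs t

  All≢⇒¬any== : ∀ {x : Fin n} {xs} → All (x ≢_) xs → T (not (any (x ==_) xs))
  All≢⇒¬any==         []              = tt
  All≢⇒¬any== {x} {y ∷ _} (x≢y ∷ x∉xs) with x ≟ y
  ... | yes x≡y = contradiction x≡y x≢y
  ... | no _    = All≢⇒¬any== x∉xs

  distinct⇒Unique : ∀ (xs : List (Fin n)) → T (distinct xs) → Unique xs
  distinct⇒Unique []       _ = []
  distinct⇒Unique (x ∷ xs) t =
    let x∉xs , d = Equivalence.to T-∧ t in ¬any==⇒All≢ x xs x∉xs ∷ distinct⇒Unique xs d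

  Unique⇒distinct : ∀ {xs : List (Fin n)} → Unique xs → T (distinct xs)
  Unique⇒distinct []           = tt
  Unique⇒distinct (x∉xs ∷ u) = Equivalence.from T-∧ (All≢⇒¬any== x∉xs , Unique⇒distinct u)

  ∈-words⁻ : ∀ k {xs : List (Fin n)} → xs ∈ words k → length xs ≡ k
  ∈-words⁻ zero    (here refl) = refl
  ∈-words⁻ (suc k) xs∈ with Any.satisfied (∈-concatMap⁻ (λ v → map (v ∷_) (words k)) {xs = allFin n} xs∈)
  ... | v , vys∈ with ∈-map⁻ (v ∷_) vys∈
  ... | ys , ys∈ , refl = cong suc (∈-words⁻ k ys∈)

  ∈-words⁺ : ∀ (xs : List (Fin n)) → xs ∈ words (length xs)
  ∈-words⁺ []       = here refl
  ∈-words⁺ (v ∷ xs) =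
    ∈-concatMap⁺ (λ v → map (v ∷_) (words (length xs))) (lose (∈-allFin v) (∈-map⁺ (v ∷_) (∈-words⁺ xs)))

  words-unique : ∀ k → Unique (words {n} k)
  words-unique zero    = [] ∷ []
  words-unique (suc k) =
    Unique.concat⁺ (All.map⁺ (All.tabulate (λ _ → Unique.map⁺ ∷-injectiveʳ (words-unique k))))
                   (AllPairs.map⁺ (AllPairs.map disjoint (Unique.allFin⁺ n)))
    where
    disjoint : ∀ {u v : Fin n} → u ≢ v → ∀ {ys} → ¬ (ys ∈ map (u ∷_) (words k) × ys ∈ map (v ∷_) (words k))
    disjoint u≢v (ys∈ , ys∈′) with ∈-map⁻ _ ys∈ | ∈-map⁻ _ ys∈′
    ... | _ , _ , refl | _ , _ , eq = u≢v (∷-injectiveˡ eq)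

  ∈-permutations⁻ : ∀ {xs} → xs ∈ permutations n → length xs ≡ n × Unique xs
  ∈-permutations⁻ {xs} xs∈ =
    let xs∈words , d = ∈-filter⁻ (λ ys → T? (distinct ys)) {xs = words n} xs∈
    in ∈-words⁻ n xs∈words , distinct⇒Unique xs d

  ∈-permutations⁺ : ∀ {xs} → length xs ≡ n → Unique xs → xs ∈ permutations n
  ∈-permutations⁺ {xs} len u =
    ∈-filter⁺ (λ ys → T? (distinct ys)) (subst (λ k → xs ∈ words k) len (∈-words⁺ xs)) (Unique⇒distinct u)

  permutations-unique : Unique (permutations n)
  permutations-unique = Unique.filter⁺ _ (words-unique n)

  ∈-permutations-resp-↭ : ∀ {xs ys} → xs ↭ ys → ys ∈ permutations n → xs ∈ permutations n
  ∈-permutations-resp-↭ xs↭ys ys∈ =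
    let len , u = ∈-permutations⁻ ys∈
    in ∈-permutations⁺ (trans (↭-length xs↭ys) len) (Unique-resp-↭ (↭⇒↭ₛ (↭-sym xs↭ys)) u)

  count-reverse : ∀ (P : List (Fin n) → Bool) →
    count P (permutations n) ≡ count (P ∘ reverse) (permutations n)
  count-reverse P = trans (count-↭ P (↭-sym reversed↭)) (count-map P reverse (permutations n))
    where
    reverse∈ : ∀ {xs} → xs ∈ permutations n → reverse xs ∈ permutations n
    reverse∈ {xs} = ∈-permutations-resp-↭ (↭-reverse xs)
    reversed↭ : map reverse (permutations n) ↭ permutations n
    reversed↭ = ∼bag⇒↭ (unique∧set⇒bag (Unique.map⁺ reverse-injective permutations-unique) permutations-unique
      λ {xs} → mk⇔ (λ xs∈ → let _ , ys∈ , xs≡ = ∈-map⁻ reverse xs∈ in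
                              subst (_∈ permutations n) (sym xs≡) (reverse∈ ys∈))
                   (λ xs∈ → subst (_∈ map reverse (permutations n)) (reverse-involutive xs)
                                  (∈-map⁺ reverse (reverse∈ xs∈))))

-- Segmentations into paths and Rédei's theorem

isSingleton : ∀ {A : Set} → List A → Bool
isSingleton (_ ∷ []) = true
isSingleton _        = false

module Segmentation {V : Set} (w : V → V → Bool) where

  IsPath : List V → Set
  IsPath []      = ⊥
  IsPath (p ∷ s) = T (allSteps w (p ∷ s))

  extend : V → List (List V) → List (List V)
  extend p []      = []
  extend p (s ∷ σ) = (p ∷ s) ∷ σ

  segmentations : V → List V → List (List (List V))
  segmentations p []      = [ [ [ p ] ] ]
  segmentations p (q ∷ r) =
    map ([ p ] ∷_) (segmentations q r) ++ (if w p q then map (extend p) (segmentations q r) else [])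

  first-segment : ∀ {q r τ} → concat τ ≡ q ∷ r → All IsPath τ → ∃₂ λ s τ′ → τ ≡ (q ∷ s) ∷ τ′
  first-segment {τ = []}            ()  _
  first-segment {τ = [] ∷ _}        _   (() ∷ _)
  first-segment {τ = (_ ∷ s) ∷ τ′} eq  _ with refl ← ∷-injectiveˡ eq = s , τ′ , refl

  ∈-segmentations⁻ : ∀ p r {σ} → σ ∈ segmentations p r → concat σ ≡ p ∷ r × All IsPath σ
  ∈-segmentations⁻ p []      (here refl) = refl , (tt ∷ [])
  ∈-segmentations⁻ p (q ∷ r) σ∈ with ∈-++⁻ (map ([ p ] ∷_) (segmentations q r)) σ∈
  ... | inj₁ σ∈cut with τ , τ∈ , refl ← ∈-map⁻ ([ p ] ∷_) σ∈cut =
    let eq , paths = ∈-segmentations⁻ q r τ∈ in cong (p ∷_) eq , (tt ∷ paths)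
  ∈-segmentations⁻ p (q ∷ r) σ∈ | inj₂ σ∈join with w p q in wpq
  ... | true with τ , τ∈ , refl ← ∈-map⁻ (extend p) σ∈join
             with eq , paths ← ∈-segmentations⁻ q r τ∈
             with s , τ′ , refl ← first-segment {q} {r} {τ} eq paths
             with path ∷ paths′ ← paths =
    cong (p ∷_) eq , (subst (λ b → T (b ∧ allSteps w (q ∷ s))) (sym wpq) path ∷ paths′)

  ∈-segmentations⁺ : ∀ p s τ → T (allSteps w (p ∷ s)) → All IsPath τ → ((p ∷ s) ∷ τ) ∈ segmentations p (s ++ concat τ)
  ∈-segmentations⁺ p []      []               _    _              = here refl
  ∈-segmentations⁺ p []      ((q ∷ s) ∷ τ)   _    (path ∷ paths) =
    ∈-++⁺ˡ (∈-map⁺ ([ p ] ∷_) (∈-segmentations⁺ q s τ path paths))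
  ∈-segmentations⁺ p (q ∷ s) τ               path paths with w p q
  ... | true = ∈-++⁺ʳ (map ([ p ] ∷_) (segmentations q (s ++ concat τ)))
                      (∈-map⁺ (extend p) (∈-segmentations⁺ q s τ path paths))

  segmentations-unique : ∀ p r → Unique (segmentations p r)
  segmentations-unique p []      = [] ∷ []
  segmentations-unique p (q ∷ r) =
    Unique.++⁺ (Unique.map⁺ ∷-injectiveʳ (segmentations-unique q r)) joins-unique cut∩join≡∅
    where
    extend-injective : ∀ {σ σ′} → extend p σ ≡ extend p σ′ → σ ≡ σ′
    extend-injective {[]}    {[]}     _  = refl
    extend-injective {_ ∷ _} {_ ∷ _} eq = let eq₁ , eq₂ = ∷-injective eq in cong₂ _∷_ (∷-injectiveʳ eq₁) eq₂
    joins-unique : Unique (if w p q then map (extend p) (segmentations q r) else [])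
    joins-unique with w p q
    ... | true  = Unique.map⁺ extend-injective (segmentations-unique q r)
    ... | false = []
    cut∩join≡∅ : ∀ {σ} →
      ¬ (σ ∈ map ([ p ] ∷_) (segmentations q r) × σ ∈ (if w p q then map (extend p) (segmentations q r) else []))
    cut∩join≡∅ (σ∈cut , σ∈join) with w p q
    ... | true with _ , _ , refl ← ∈-map⁻ ([ p ] ∷_) σ∈cut
               with τ , τ∈ , eq ← ∈-map⁻ (extend p) σ∈join
               with s , τ′ , refl ← uncurry (first-segment {q} {r} {τ}) (∈-segmentations⁻ q r τ∈)
               with () ← ∷-injectiveʳ (∷-injectiveˡ eq)

  -- A step in w may be cut or not, a step not in w must be cut: 2^(number of steps in w) segmentations.
  parity-length-segmentations : ∀ p r →
    parity (length (segmentations p r)) ≡ parity (if allSteps (λ a b → not (w a b)) (p ∷ r) then 1 else 0)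
  parity-length-segmentations p []      = refl
  parity-length-segmentations p (q ∷ r) with w p q
  ... | true  = begin
    parity (length (map ([ p ] ∷_) τs ++ map (extend p) τs))
      ≡⟨ cong parity (length-++ (map ([ p ] ∷_) τs)) ⟩
    parity (length (map ([ p ] ∷_) τs) + length (map (extend p) τs))
      ≡⟨ cong₂ (λ a b → parity (a + b)) (length-map ([ p ] ∷_) τs) (length-map (extend p) τs) ⟩
    parity (length τs + length τs)
      ≡⟨ ℙ.+-homo-+ (length τs) _ ⟩
    parity (length τs) ℙ.+ parity (length τs)
      ≡⟨ ℙ.p+p≡0ℙ (parity (length τs)) ⟩
    0ℙ ∎
    where
    open ≡-Reasoning
    τs = segmentations q r
  ... | false = begin
    parity (length (map ([ p ] ∷_) τs ++ []))
      ≡⟨ cong parity (trans (cong length (++-identityʳ (map ([ p ] ∷_) τs))) (length-map ([ p ] ∷_) τs)) ⟩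
    parity (length τs)
      ≡⟨ parity-length-segmentations q r ⟩
    parity (if allSteps (λ a b → not (w a b)) (q ∷ r) then 1 else 0) ∎
    where
    open ≡-Reasoning
    τs = segmentations q r

  count-singleton-segmentations : ∀ p r →
    count isSingleton (segmentations p r) ≡ (if allSteps w (p ∷ r) then 1 else 0)
  count-singleton-segmentations p []      = refl
  count-singleton-segmentations p (q ∷ r) = begin
    count isSingleton (map ([ p ] ∷_) τs ++ joins)
      ≡⟨ count-++ isSingleton (map ([ p ] ∷_) τs) joins ⟩
    count isSingleton (map ([ p ] ∷_) τs) + count isSingleton joins
      ≡⟨ cong (_+ count isSingleton joins) cuts-not-singleton ⟩
    count isSingleton joins
      ≡⟨ joins-singletons ⟩
    (if allSteps w (p ∷ q ∷ r) then 1 else 0) ∎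
    where
    open ≡-Reasoning
    τs = segmentations q r
    joins = if w p q then map (extend p) τs else []
    cuts-not-singleton : count isSingleton (map ([ p ] ∷_) τs) ≡ 0
    cuts-not-singleton = trans (count-map isSingleton ([ p ] ∷_) τs) (trans (count-cong τs nonempty) (count-false τs))
      where
      nonempty : ∀ {τ} → τ ∈ τs → isSingleton ([ p ] ∷ τ) ≡ false
      nonempty {[]}    τ∈ with () ← proj₁ (∈-segmentations⁻ q r τ∈)
      nonempty {_ ∷ _} _ = refl
    joins-singletons : count isSingleton joins ≡ (if allSteps w (p ∷ q ∷ r) then 1 else 0)
    joins-singletons with w p q
    ... | false = refl
    ... | true  = trans (count-map isSingleton (extend p) τs)
                  (trans (count-cong τs extend-singleton) (count-singleton-segmentations q r))
      where
      extend-singleton : ∀ {τ} → τ ∈ τs → isSingleton (extend p τ) ≡ isSingleton τ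
      extend-singleton {[]}        _ = refl
      extend-singleton {_ ∷ []}    _ = refl
      extend-singleton {_ ∷ _ ∷ _} _ = refl

swapFirstTwo : ∀ {A : Set} → List A → List A
swapFirstTwo (a ∷ b ∷ r) = b ∷ a ∷ r
swapFirstTwo l           = l

swapFirstTwo-involutive : ∀ {A : Set} (l : List A) → swapFirstTwo (swapFirstTwo l) ≡ l
swapFirstTwo-involutive []          = refl
swapFirstTwo-involutive (_ ∷ [])    = refl
swapFirstTwo-involutive (_ ∷ _ ∷ _) = refl

++-swap-↭ : ∀ {A : Set} (xs ys zs : List A) → xs ++ ys ++ zs ↭ ys ++ xs ++ zs
++-swap-↭ xs ys zs = subst₂ _↭_ (++-assoc xs ys zs) (++-assoc ys xs zs) (++⁺ʳ zs (↭-++-comm xs ys))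

module SegmentedPermutations {m : ℕ} (w : Fin (suc m) → Fin (suc m) → Bool) where

  open Segmentation w

  private
    V = Fin (suc m)
    perms = permutations (suc m)

  segmentationsOf : List V → List (List (List V))
  segmentationsOf []      = []
  segmentationsOf (p ∷ r) = segmentations p r

  -- The pairs (x, σ) with σ a segmentation of the permutation x, stored as σ alone since x = concat σ.
  segmented : List (List (List V))
  segmented = concatMap segmentationsOf perms

  ∈-segmentationsOf⁻ : ∀ x {σ} → σ ∈ segmentationsOf x → concat σ ≡ x × All IsPath σ
  ∈-segmentationsOf⁻ (p ∷ r) = ∈-segmentations⁻ p r

  parity-length-segmented : parity (length segmented) ≡ parity (count (allSteps (λ p q → not (w p q))) perms)
  parity-length-segmented = parity-length-concatMap segmentationsOf perms parity-length
    where
    parity-length : ∀ {x} → x ∈ perms →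
      parity (length (segmentationsOf x)) ≡ parity (if allSteps (λ p q → not (w p q)) x then 1 else 0)
    parity-length {p ∷ r} _  = parity-length-segmentations p r
    parity-length {[]}    x∈ with () ← proj₁ (∈-permutations⁻ x∈)

  count-singleton-segmented : count isSingleton segmented ≡ count (allSteps w) perms
  count-singleton-segmented = count-concatMap segmentationsOf perms count-singletons
    where
    count-singletons : ∀ {x} → x ∈ perms → count isSingleton (segmentationsOf x) ≡ (if allSteps w x then 1 else 0)
    count-singletons {p ∷ r} _  = count-singleton-segmentations p r
    count-singletons {[]}    x∈ with () ← proj₁ (∈-permutations⁻ x∈)

  segmented-unique : Unique segmented
  segmented-unique = Unique.concat⁺ (All.map⁺ (All.tabulate segmentationsOf-unique))
                                    (AllPairs.map⁺ (AllPairs.map disjoint permutations-unique))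
    where
    segmentationsOf-unique : ∀ {x} → x ∈ perms → Unique (segmentationsOf x)
    segmentationsOf-unique {p ∷ r} _ = segmentations-unique p r
    segmentationsOf-unique {[]}    _ = []
    disjoint : ∀ {x y} → x ≢ y → ∀ {σ} → ¬ (σ ∈ segmentationsOf x × σ ∈ segmentationsOf y)
    disjoint {x} {y} x≢y (σ∈x , σ∈y) =
      x≢y (trans (sym (proj₁ (∈-segmentationsOf⁻ x σ∈x))) (proj₁ (∈-segmentationsOf⁻ y σ∈y)))

  ∈-non-singleton-segmented⁻ : ∀ {σ} → σ ∈ filter (λ σ → T? (not (isSingleton σ))) segmented →
    ∃₂ λ s₁ s₂ → ∃ λ τ → σ ≡ s₁ ∷ s₂ ∷ τ × All IsPath σ × concat σ ∈ perms
  ∈-non-singleton-segmented⁻ {σ} σ∈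
    with σ∈S , non-singleton ← ∈-filter⁻ _ {xs = segmented} σ∈
    with x , x∈ , σ∈x ← find (∈-concatMap⁻ segmentationsOf {xs = perms} σ∈S)
    with concat≡x , paths ← ∈-segmentationsOf⁻ x σ∈x
    with σ
  ... | []          with refl ← concat≡x with () ← σ∈x
  ... | s₁ ∷ s₂ ∷ τ = s₁ , s₂ , τ , refl , paths , subst (_∈ perms) (sym concat≡x) x∈

  parity-count-non-singleton-segmented : parity (count (not ∘ isSingleton) segmented) ≡ 0ℙ
  parity-count-non-singleton-segmented =
    involution-even (≡-dec (≡-dec _≟_)) swapFirstTwo swapFirstTwo-involutive
                    _ (Unique.filter⁺ _ segmented-unique) closed fixed-point-free
    where
    closed : ∀ {σ} → σ ∈ filter (λ σ → T? (not (isSingleton σ))) segmented →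
      swapFirstTwo σ ∈ filter (λ σ → T? (not (isSingleton σ))) segmented
    closed σ∈ with ∈-non-singleton-segmented⁻ σ∈
    ... | s₁ , q ∷ s₂ , τ , refl , path₁ ∷ path₂ ∷ paths , concat∈ =
      ∈-filter⁺ _ (∈-concatMap⁺ segmentationsOf (lose swapped-concat∈ swapped∈)) tt
      where
      swapped-concat∈ : concat ((q ∷ s₂) ∷ s₁ ∷ τ) ∈ perms
      swapped-concat∈ = ∈-permutations-resp-↭ (++-swap-↭ (q ∷ s₂) s₁ (concat τ)) concat∈
      swapped∈ : ((q ∷ s₂) ∷ s₁ ∷ τ) ∈ segmentations q (s₂ ++ concat (s₁ ∷ τ))
      swapped∈ = ∈-segmentations⁺ q s₂ (s₁ ∷ τ) path₂ (path₁ ∷ paths)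
    fixed-point-free : ∀ {σ} → σ ∈ filter (λ σ → T? (not (isSingleton σ))) segmented → swapFirstTwo σ ≢ σ
    fixed-point-free σ∈ swapped≡σ with ∈-non-singleton-segmented⁻ σ∈
    ... | [] , _ , _ , refl , () ∷ _ , _
    ... | q ∷ s , s₂ , τ , refl , _ , concat∈ with refl ← ∷-injectiveˡ swapped≡σ
      with q∉ ∷ _ ← proj₂ (∈-permutations⁻ concat∈) = All¬⇒¬Any q∉ (∈-++⁺ʳ s (here refl))

-- Berge: mod 2 the segmentations of all permutations into w-paths are as many as the permutations with no step
-- in w; swapping the first two segments pairs off those with at least two segments, and those with one segment
-- are the permutations with every step in w.
parity-count-allSteps-complement : ∀ n (w : Fin n → Fin n → Bool) →
  parity (count (allSteps w) (permutations n)) ≡ parity (count (allSteps (λ p q → not (w p q))) (permutations n))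
parity-count-allSteps-complement zero    w = refl
parity-count-allSteps-complement (suc m) w = begin
  parity (count (allSteps w) (permutations (suc m)))
    ≡⟨ cong parity count-singleton-segmented ⟨
  parity (count isSingleton segmented)
    ≡⟨ ℙ.+-identityʳ _ ⟨
  parity (count isSingleton segmented) ℙ.+ 0ℙ
    ≡⟨ cong (parity (count isSingleton segmented) ℙ.+_) parity-count-non-singleton-segmented ⟨
  parity (count isSingleton segmented) ℙ.+ parity (count (not ∘ isSingleton) segmented)
    ≡⟨ ℙ.+-homo-+ (count isSingleton segmented) _ ⟨
  parity (count isSingleton segmented + count (not ∘ isSingleton) segmented)
    ≡⟨ cong parity (length-split isSingleton segmented) ⟨
  parity (length segmented)
    ≡⟨ parity-length-segmented ⟩
  parity (count (allSteps (λ p q → not (w p q))) (permutations (suc m))) ∎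
  where
  open ≡-Reasoning
  open SegmentedPermutations w

-- Mixed graphs

T-ext : ∀ {b c} → (T b → T c) → (T c → T b) → b ≡ c
T-ext {true}  {true}  _  _    = refl
T-ext {true}  {false} to _    = ⊥-elim (to tt)
T-ext {false} {true}  _  from = ⊥-elim (from tt)
T-ext {false} {false} _  _    = refl

∧-swapʳ : ∀ p q r → (p ∧ q) ∧ r ≡ (p ∧ r) ∧ q
∧-swapʳ = xy∙z≈xz∙y
  where
  open import Algebra.Properties.CommutativeSemigroup (CommutativeMonoid.commutativeSemigroup ∧-commutativeMonoid)

module _ {n : ℕ} where

  samePair⁻ : ∀ {u v a b : Fin n} → T (samePair u v a b) → (u ≡ a × v ≡ b) ⊎ (u ≡ b × v ≡ a)
  samePair⁻ {u} {v} {a} {b} t with Equivalence.to (T-∨ {u == a ∧ v == b}) t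
  ... | inj₁ t₁ = let ua , vb = Equivalence.to (T-∧ {u == a}) t₁ in inj₁ (toWitness ua , toWitness vb)
  ... | inj₂ t₂ = let ub , va = Equivalence.to (T-∧ {u == b}) t₂ in inj₂ (toWitness ub , toWitness va)

  samePair⁺ : ∀ {u v a b : Fin n} → (u ≡ a × v ≡ b) ⊎ (u ≡ b × v ≡ a) → T (samePair u v a b)
  samePair⁺ {u} {v} (inj₁ (refl , refl)) = Equivalence.from (T-∨ {u == u ∧ v == v})
    (inj₁ (Equivalence.from (T-∧ {u == u}) (fromWitness refl , fromWitness refl)))
  samePair⁺ {u} {v} (inj₂ (refl , refl)) = Equivalence.from (T-∨ {u == v ∧ v == u})
    (inj₂ (Equivalence.from (T-∧ {u == u}) (fromWitness refl , fromWitness refl)))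

  contains⁻ : ∀ x {u v : Fin n} → T (contains x u v) → (u , v) ∈ neighbours x ⊎ (v , u) ∈ neighbours x
  contains⁻ x {u} {v} t with (p , q) , pq∈ , same ← find (any⁻ _ (neighbours x) t) with samePair⁻ {p} {q} {u} {v} same
  ... | inj₁ (refl , refl) = inj₁ pq∈
  ... | inj₂ (refl , refl) = inj₂ pq∈

  contains⁺ : ∀ x {u v : Fin n} → (u , v) ∈ neighbours x ⊎ (v , u) ∈ neighbours x → T (contains x u v)
  contains⁺ x {u} {v} (inj₁ uv∈) = any⁺ _ (lose uv∈ (samePair⁺ {u} {v} {u} {v} (inj₁ (refl , refl))))
  contains⁺ x {u} {v} (inj₂ vu∈) = any⁺ _ (lose vu∈ (samePair⁺ {v} {u} {u} {v} (inj₂ (refl , refl))))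

  hasStep : List (Fin n) → Fin n → Fin n → Bool
  hasStep x p q = any (λ (u , v) → u == p ∧ v == q) (neighbours x)

  hasStep⁻ : ∀ x {p q} → T (hasStep x p q) → (p , q) ∈ neighbours x
  hasStep⁻ x {p} {q} t with (u , v) , uv∈ , same ← find (any⁻ _ (neighbours x) t)
    with up , vq ← Equivalence.to (T-∧ {u == p}) same
    with refl ← toWitness up | refl ← toWitness vq = uv∈

  contains≡hasStep∨hasStep : ∀ x (a b : Fin n) → contains x a b ≡ hasStep x a b ∨ hasStep x b a
  contains≡hasStep∨hasStep x a b = any-∨ (λ (u , v) → u == a ∧ v == b) (λ (u , v) → u == b ∧ v == a) (neighbours x)

  contains-sym : ∀ x (u v : Fin n) → contains x u v ≡ contains x v u
  contains-sym x u v = begin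
    contains x u v                 ≡⟨ contains≡hasStep∨hasStep x u v ⟩
    hasStep x u v ∨ hasStep x v u  ≡⟨ ∨-comm (hasStep x u v) _ ⟩
    hasStep x v u ∨ hasStep x u v  ≡⟨ contains≡hasStep∨hasStep x v u ⟨
    contains x v u                 ∎
    where open ≡-Reasoning

  contains-samePair : ∀ x {u v a b : Fin n} → T (samePair u v a b) → contains x u v ≡ contains x a b
  contains-samePair x {u} {v} {a} {b} same with samePair⁻ {u} {v} {a} {b} same
  ... | inj₁ (refl , refl) = refl
  ... | inj₂ (refl , refl) = contains-sym x b a

  InE₁₂ : MixedGraph n → Fin n → Fin n → Set
  InE₁₂ G u v = u ≢ v × T (inE12 (kind G u v))

  InE₁₂-sym : ∀ G {u v} → InE₁₂ G u v → InE₁₂ G v u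
  InE₁₂-sym G {u} {v} (u≢v , uv∈) =
    (λ v≡u → u≢v (sym v≡u)) , subst (T ∘ inE12) (sym (kind-sym G u v u≢v)) (inE12-flip uv∈)
    where
    inE12-flip : ∀ {k} → T (inE12 k) → T (inE12 (flipK k))
    inE12-flip {non}   _ = tt
    inE12-flip {undir} _ = tt

  InE₁₂? : ∀ G (u v : Fin n) → Dec (InE₁₂ G u v)
  InE₁₂? G u v = ¬? (u ≟ v) ×-dec T? (inE12 (kind G u v))

  guarded : MixedGraph n → (Fin n → Fin n → Bool) → Fin n → Fin n → Bool
  guarded G P u v = not (not (u == v) ∧ inE12 (kind G u v)) ∨ P u v

  forallE12⁻ : ∀ G {P} → T (forallE12 G P) → ∀ {u v} → InE₁₂ G u v → T (P u v)
  forallE12⁻ G t {u} {v} (u≢v , uv∈)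
    with All.lookup (all⁺ _ _ (All.lookup (all⁺ _ _ t) (∈-allFin u))) (∈-allFin v)
  ... | t′ with u ≟ v | inE12 (kind G u v)
  ... | yes u≡v | _    = contradiction u≡v u≢v
  ... | no _    | true = t′

  forallE12⁺ : ∀ G {P} → (∀ {u v} → InE₁₂ G u v → T (P u v)) → T (forallE12 G P)
  forallE12⁺ G {P} h = all⁻ _ {allFin n} (All.tabulate λ {u} _ → all⁻ _ {allFin n} (All.tabulate λ {v} _ → at u v))
    where
    at : ∀ u v → T (guarded G P u v)
    at u v with u ≟ v | inE12 (kind G u v) in uv∈
    ... | yes _   | _     = tt
    ... | no _    | false = tt
    ... | no u≢v  | true  = h (u≢v , subst T (sym uv∈) tt)

  forallE12-cong : ∀ G G′ P P′ → (∀ u v → guarded G P u v ≡ guarded G′ P′ u v) → forallE12 G P ≡ forallE12 G′ P′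
  forallE12-cong _ _ _ _ eq = cong and (map-cong (λ u → cong and (map-cong (eq u) (allFin n))) (allFin n))

  -- Shrinking the guard of forallE12 by a pair s is the same as exempting s in the body.
  guard-absorb : ∀ d e s c → not (d ∧ (e ∧ not s)) ∨ c ≡ not (d ∧ e) ∨ (s ∨ c)
  guard-absorb true  true  true  c = refl
  guard-absorb true  true  false c = refl
  guard-absorb true  false s     c = refl
  guard-absorb false e     s     c = refl

  orientKind : Bool → Bool → Kind → Kind
  orientKind forward backward k = if forward then out else if backward then inn else k

  orientKind-flip : ∀ x y k → ¬ (T x × T y) → orientKind y x (flipK k) ≡ flipK (orientKind x y k)
  orientKind-flip true  true  k both = contradiction (tt , tt) both
  orientKind-flip true  false k _    = refl
  orientKind-flip false true  k _    = refl
  orientKind-flip false false k _    = refl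

  orient : (G : MixedGraph n) (a b : Fin n) → a ≢ b → MixedGraph n
  orient G a b a≢b = record { kind = kind′ ; kind-sym = kind′-sym }
    where
    kind′ : Fin n → Fin n → Kind
    kind′ u v = orientKind (u == a ∧ v == b) (u == b ∧ v == a) (kind G u v)
    kind′-sym : ∀ i j → i ≢ j → kind′ j i ≡ flipK (kind′ i j)
    kind′-sym i j i≢j = begin
      orientKind (j == a ∧ i == b) (j == b ∧ i == a) (kind G j i)
        ≡⟨ cong₂ (λ x y → orientKind x y (kind G j i)) (∧-comm (j == a) (i == b)) (∧-comm (j == b) (i == a)) ⟩
      orientKind (i == b ∧ j == a) (i == a ∧ j == b) (kind G j i)
        ≡⟨ cong (orientKind (i == b ∧ j == a) (i == a ∧ j == b)) (kind-sym G i j i≢j) ⟩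
      orientKind (i == b ∧ j == a) (i == a ∧ j == b) (flipK (kind G i j))
        ≡⟨ orientKind-flip (i == a ∧ j == b) (i == b ∧ j == a) (kind G i j) not-both ⟩
      flipK (kind′ i j) ∎
      where
      open ≡-Reasoning
      not-both : ¬ (T (i == a ∧ j == b) × T (i == b ∧ j == a))
      not-both (ab , ba) =
        a≢b (trans (sym (toWitness (proj₁ (Equivalence.to (T-∧ {i == a}) ab))))
                   (toWitness (proj₁ (Equivalence.to (T-∧ {i == b}) ba))))

  inE12-orientKind : ∀ x y k → inE12 (orientKind x y k) ≡ inE12 k ∧ not (x ∨ y)
  inE12-orientKind true  _     k = sym (∧-zeroʳ (inE12 k))
  inE12-orientKind false true  k = sym (∧-zeroʳ (inE12 k))
  inE12-orientKind false false k = sym (∧-identityʳ (inE12 k))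

  inE3bar-orientKind : ∀ x y k → (T x → inE3bar k ≡ false × y ≡ false) → inE3bar (orientKind x y k) ≡ inE3bar k ∨ y
  inE3bar-orientKind true  _     k h with k≢inn , refl ← h tt = sym (trans (∨-identityʳ _) k≢inn)
  inE3bar-orientKind false true  k _ = sym (∨-zeroʳ (inE3bar k))
  inE3bar-orientKind false false k _ = sym (∨-identityʳ (inE3bar k))

  inE12⇒¬inE3bar : ∀ k → T (inE12 k) → inE3bar k ≡ false
  inE12⇒¬inE3bar non   _ = refl
  inE12⇒¬inE3bar undir _ = refl

  module _ (G : MixedGraph n) {a b : Fin n} (a≢b : a ≢ b) where

    inE12-orient : ∀ u v → inE12 (kind (orient G a b a≢b) u v) ≡ inE12 (kind G u v) ∧ not (samePair u v a b)
    inE12-orient u v = inE12-orientKind (u == a ∧ v == b) (u == b ∧ v == a) (kind G u v)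

    containsE12-orient : ∀ x → containsE12 (orient G a b a≢b) x ≡ containsA G a b x
    containsE12-orient x =
      forallE12-cong (orient G a b a≢b) G (contains x) (λ u v → samePair u v a b ∨ contains x u v) λ u v →
      begin
      not (not (u == v) ∧ inE12 (kind (orient G a b a≢b) u v)) ∨ contains x u v
        ≡⟨ cong (λ e → not (not (u == v) ∧ e) ∨ contains x u v) (inE12-orient u v) ⟩
      not (not (u == v) ∧ (inE12 (kind G u v) ∧ not (samePair u v a b))) ∨ contains x u v
        ≡⟨ guard-absorb (not (u == v)) (inE12 (kind G u v)) (samePair u v a b) (contains x u v) ⟩
      guarded G (λ u v → samePair u v a b ∨ contains x u v) u v ∎
      where open ≡-Reasoning

    containsA-sym : ∀ x → containsA G b a x ≡ containsA G a b x
    containsA-sym x =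
      forallE12-cong G G (λ u v → samePair u v b a ∨ contains x u v) (λ u v → samePair u v a b ∨ contains x u v)
        λ u v → cong (λ s → not (not (u == v) ∧ inE12 (kind G u v)) ∨ (s ∨ contains x u v)) (∨-comm (u == b ∧ v == a) _)

    avoidsE3bar-orient : T (inE12 (kind G a b)) → ∀ x →
      avoidsE3bar (orient G a b a≢b) x ≡ avoidsE3bar G x ∧ not (hasStep x b a)
    avoidsE3bar-orient ab∈ x = trans
      (cong and (map-cong (λ (p , q) → cong not (inE3bar-orientKind (p == a ∧ q == b) (p == b ∧ q == a) (kind G p q)
                                                                     (unreversed p q)))
                          (neighbours x)))
      (all-not-∨ (λ (p , q) → inE3bar (kind G p q)) (λ (p , q) → p == b ∧ q == a) (neighbours x))
      where
      unreversed : ∀ p q → T (p == a ∧ q == b) → inE3bar (kind G p q) ≡ false × (p == b ∧ q == a) ≡ false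
      unreversed p q t with refl ← toWitness (proj₁ (Equivalence.to (T-∧ {p == a}) t))
                      | refl ← toWitness (proj₂ (Equivalence.to (T-∧ {p == a}) t)) with a ≟ b
      ... | yes a≡b = contradiction a≡b a≢b
      ... | no _    = inE12⇒¬inE3bar (kind G p q) ab∈ , refl

  InE₁₂-orient⁻ : ∀ G {c d u v} (c≢d : c ≢ d) → InE₁₂ (orient G c d c≢d) u v → InE₁₂ G u v × ¬ T (samePair u v c d)
  InE₁₂-orient⁻ G {u = u} {v} c≢d (u≢v , uv∈) =
    let uv∈G , ¬same = split (subst T (inE12-orient G c≢d u v) uv∈) in (u≢v , uv∈G) , ¬same
    where
    split : ∀ {e s} → T (e ∧ not s) → T e × ¬ T s
    split {true} {false} _ = tt , λ ()

  InE₁₂-orient⁺ : ∀ G {c d u v} (c≢d : c ≢ d) → InE₁₂ G u v → ¬ T (samePair u v c d) → InE₁₂ (orient G c d c≢d) u v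
  InE₁₂-orient⁺ G {u = u} {v} c≢d (u≢v , uv∈) ¬same =
    u≢v , subst T (sym (inE12-orient G c≢d u v)) (conclude uv∈ ¬same)
    where
    conclude : ∀ {e s} → T e → ¬ T s → T (e ∧ not s)
    conclude {true} {false} _ _  = tt
    conclude {true} {true}  _ ¬s = ¬s tt

  module _ (G : MixedGraph n) {a b : Fin n} (ab∈ : InE₁₂ G a b) where

    private
      perms = permutations n
      Q : List (Fin n) → Bool
      Q x = containsA G a b x ∧ avoidsE3bar G x

    containsE12-split : ∀ x → containsE12 G x ≡ containsA G a b x ∧ contains x a b
    containsE12-split x = T-ext to from
      where
      to : T (containsE12 G x) → T (containsA G a b x ∧ contains x a b)
      to t = Equivalence.from T-∧
        ( forallE12⁺ G {λ u v → samePair u v a b ∨ contains x u v}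
                     (λ uv∈ → Equivalence.from T-∨ (inj₂ (forallE12⁻ G t uv∈)))
        , forallE12⁻ G t ab∈)
      from : T (containsA G a b x ∧ contains x a b) → T (containsE12 G x)
      from t = forallE12⁺ G {contains x} at
        where
        at : ∀ {u v} → InE₁₂ G u v → T (contains x u v)
        at {u} {v} uv∈ with Equivalence.to (T-∧ {containsA G a b x}) t
        ... | tA , tab with Equivalence.to (T-∨ {samePair u v a b}) (forallE12⁻ G tA uv∈)
        ...   | inj₁ same = subst T (sym (contains-samePair x same)) tab
        ...   | inj₂ tuv  = tuv

    -- The body of exactlyA is "contains x u v xor samePair u v a b".
    exactlyA-split : ∀ x → exactlyA G a b x ≡ containsA G a b x ∧ not (contains x a b)
    exactlyA-split x = T-ext to from
      where
      xor⇒∨ : ∀ c s → T ((c ∧ not s) ∨ (not c ∧ s)) → T (s ∨ c)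
      xor⇒∨ true  false _ = tt
      xor⇒∨ false true  _ = tt
      xor-true : ∀ c s → T s → T ((c ∧ not s) ∨ (not c ∧ s)) → T (not c)
      xor-true false true _ _ = tt
      xor-intro : ∀ c s → T (s ∨ c) → (T s → T (not c)) → T ((c ∧ not s) ∨ (not c ∧ s))
      xor-intro true  false _ _   = tt
      xor-intro false true  _ _   = tt
      xor-intro true  true  _ s⇒¬c = s⇒¬c tt
      to : T (exactlyA G a b x) → T (containsA G a b x ∧ not (contains x a b))
      to t = Equivalence.from T-∧
        ( forallE12⁺ G {λ u v → samePair u v a b ∨ contains x u v}
                     (λ {u} {v} uv∈ → xor⇒∨ (contains x u v) (samePair u v a b) (forallE12⁻ G t uv∈))
        , xor-true (contains x a b) (samePair a b a b) (samePair⁺ {a} {b} {a} {b} (inj₁ (refl , refl)))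
                   (forallE12⁻ G t ab∈))
      from : T (containsA G a b x ∧ not (contains x a b)) → T (exactlyA G a b x)
      from t = forallE12⁺ G at
        where
        at : ∀ {u v} → InE₁₂ G u v →
          T ((contains x u v ∧ not (samePair u v a b)) ∨ (not (contains x u v) ∧ samePair u v a b))
        at {u} {v} uv∈ with Equivalence.to (T-∧ {containsA G a b x}) t
        ... | tA , t¬ab = xor-intro (contains x u v) (samePair u v a b) (forallE12⁻ G tA uv∈)
                            (λ same → subst (T ∘ not) (sym (contains-samePair x same)) t¬ab)

    N-all-pointwise : ∀ x → containsE12 G x ∧ avoidsE3bar G x ≡ Q x ∧ contains x a b
    N-all-pointwise x = trans (cong (_∧ avoidsE3bar G x) (containsE12-split x)) (∧-swapʳ (containsA G a b x) _ _)

    N-A≡N-all+N-=A : N-A G a b ≡ N-all G + N-=A G a b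
    N-A≡N-all+N-=A = trans (count-split Q (λ x → contains x a b) perms) (sym (cong₂ _+_
      (count-cong perms λ {x} _ → N-all-pointwise x)
      (count-cong perms λ {x} _ →
        trans (cong (_∧ avoidsE3bar G x) (exactlyA-split x)) (∧-swapʳ (containsA G a b x) _ _))))

    N-all-orient-pointwise : ∀ x →
      containsE12 (orient G a b (proj₁ ab∈)) x ∧ avoidsE3bar (orient G a b (proj₁ ab∈)) x ≡ Q x ∧ not (hasStep x b a)
    N-all-orient-pointwise x = begin
      containsE12 (orient G a b (proj₁ ab∈)) x ∧ avoidsE3bar (orient G a b (proj₁ ab∈)) x
        ≡⟨ cong₂ _∧_ (containsE12-orient G (proj₁ ab∈) x) (avoidsE3bar-orient G (proj₁ ab∈) (proj₂ ab∈) x) ⟩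
      containsA G a b x ∧ (avoidsE3bar G x ∧ not (hasStep x b a))
        ≡⟨ ∧-assoc (containsA G a b x) _ _ ⟨
      Q x ∧ not (hasStep x b a) ∎
      where open ≡-Reasoning

  parity-orientations : ∀ q x y → ¬ (T x × T y) →
    parity (if q ∧ (x ∨ y) then 1 else 0)
      ≡ parity (if q ∧ not y then 1 else 0) ℙ.+ parity (if q ∧ not x then 1 else 0)
  parity-orientations false _     _     _    = refl
  parity-orientations true  true  true  both = contradiction (tt , tt) both
  parity-orientations true  true  false _    = refl
  parity-orientations true  false true  _    = refl
  parity-orientations true  false false _    = refl

  parity-N-all-orient : ∀ G {a b} (ab∈ : InE₁₂ G a b) →
    parity (N-all G)
      ≡ parity (N-all (orient G a b (proj₁ ab∈))) ℙ.+ parity (N-all (orient G b a (proj₁ (InE₁₂-sym G ab∈))))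
  parity-N-all-orient G {a} {b} ab∈ = begin
    parity (N-all G)
      ≡⟨ cong parity (count-cong perms λ {x} _ →
           trans (N-all-pointwise G ab∈ x) (cong (Q x ∧_) (contains≡hasStep∨hasStep x a b))) ⟩
    parity (count (λ x → Q x ∧ (hasStep x a b ∨ hasStep x b a)) perms)
      ≡⟨ parity-count-additive perms (λ {x} x∈ →
           parity-orientations (Q x) (hasStep x a b) (hasStep x b a) (one-direction x∈)) ⟩
    parity (count (λ x → Q x ∧ not (hasStep x b a)) perms) ℙ.+ parity (count (λ x → Q x ∧ not (hasStep x a b)) perms)
      ≡⟨ cong₂ (λ m n → parity m ℙ.+ parity n) (count-cong perms λ {x} _ → N-all-orient-pointwise G ab∈ x)
                                                  (count-cong perms λ {x} _ → ba-pointwise x) ⟨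
    parity (N-all (orient G a b (proj₁ ab∈))) ℙ.+ parity (N-all (orient G b a (proj₁ (InE₁₂-sym G ab∈)))) ∎
    where
    open ≡-Reasoning
    perms = permutations n
    Q : List (Fin n) → Bool
    Q x = containsA G a b x ∧ avoidsE3bar G x
    one-direction : ∀ {x} → x ∈ perms → ¬ (T (hasStep x a b) × T (hasStep x b a))
    one-direction x∈ (ab , ba) = ∈-neighbours-asym (proj₂ (∈-permutations⁻ x∈)) (hasStep⁻ _ ab) (hasStep⁻ _ ba)
    G⃖ = orient G b a (proj₁ (InE₁₂-sym G ab∈))
    ba-pointwise : ∀ x → containsE12 G⃖ x ∧ avoidsE3bar G⃖ x ≡ Q x ∧ not (hasStep x a b)
    ba-pointwise x = trans (N-all-orient-pointwise G (InE₁₂-sym G ab∈) x)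
                           (cong (λ c → (c ∧ avoidsE3bar G x) ∧ not (hasStep x a b)) (containsA-sym G (proj₁ ab∈) x))

  forward-step : ∀ k → T (not (inE3bar k)) → ¬ T (inE12 k) → T (inE3bar (flipK k))
  forward-step non   _ ¬e = ⊥-elim (¬e tt)
  forward-step undir _ ¬e = ⊥-elim (¬e tt)
  forward-step out   _ _  = tt

  forward-step⁻ : ∀ k → T (inE3bar (flipK k)) → T (not (inE3bar k)) × ¬ T (inE12 k)
  forward-step⁻ out _ = tt , λ ()

  inE3 : MixedGraph n → Fin n → Fin n → Bool
  inE3 G p q = inE3bar (kind G q p)

  module _ (G : MixedGraph n) {a b : Fin n} (ab∈ : InE₁₂ G a b)
           (only : ∀ {u v} → InE₁₂ G u v → T (samePair u v a b)) where

    avoidsE3bar-without-ab : ∀ {x} → x ∈ permutations n → avoidsE3bar G x ∧ not (contains x a b) ≡ allSteps (inE3 G) x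
    avoidsE3bar-without-ab {x} x∈ = T-ext to from
      where
      u = proj₂ (∈-permutations⁻ x∈)
      flip-kind : ∀ {p q} → (p , q) ∈ neighbours x → kind G q p ≡ flipK (kind G p q)
      flip-kind pq∈ = kind-sym G _ _ (∈-neighbours⇒≢ u pq∈)
      to : T (avoidsE3bar G x ∧ not (contains x a b)) → T (allSteps (inE3 G) x)
      to t with Equivalence.to (T-∧ {avoidsE3bar G x}) t
      ... | t-avoids , t¬ab = allSteps⁺ (inE3 G) x λ {p} {q} pq∈ →
        subst (T ∘ inE3bar) (sym (flip-kind pq∈))
          (forward-step (kind G p q) (allSteps⁻ _ x t-avoids pq∈) λ pq∈E₁₂ →
            not-both t¬ab (subst T (contains-samePair x (only (∈-neighbours⇒≢ u pq∈ , pq∈E₁₂)))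
                                   (contains⁺ x (inj₁ pq∈))))
        where
        not-both : ∀ {c} → T (not c) → T c → ⊥
        not-both {false} _ ()
      oriented : T (allSteps (inE3 G) x) → ∀ {p q} → (p , q) ∈ neighbours x →
        T (not (inE3bar (kind G p q))) × ¬ T (inE12 (kind G p q))
      oriented t {p} {q} pq∈ =
        forward-step⁻ (kind G p q) (subst (T ∘ inE3bar) (flip-kind pq∈) (allSteps⁻ (inE3 G) x t pq∈))
      from : T (allSteps (inE3 G) x) → T (avoidsE3bar G x ∧ not (contains x a b))
      from t = Equivalence.from T-∧ (allSteps⁺ _ x (proj₁ ∘ oriented t) , avoids-ab)
        where
        avoids-ab : T (not (contains x a b))
        avoids-ab with contains x a b in ab∈x
        ... | false = tt
        ... | true with contains⁻ x (subst T (sym ab∈x) tt)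
        ...   | inj₁ ab∈nb = proj₂ (oriented t ab∈nb) (proj₂ ab∈)
        ...   | inj₂ ba∈nb = proj₂ (oriented t ba∈nb) (proj₂ (InE₁₂-sym G ab∈))

    N-all-single-edge : parity (N-all G) ≡ 0ℙ
    N-all-single-edge = ℙ.+-cancelʳ-≡ (parity (count (allSteps (inE3 G)) perms)) _ _ (begin
      parity (N-all G) ℙ.+ parity (count (allSteps (inE3 G)) perms)   ≡⟨ ℙ.+-homo-+ (N-all G) _ ⟨
      parity (N-all G + count (allSteps (inE3 G)) perms)              ≡⟨ cong parity avoiding-split ⟨
      parity (count (avoidsE3bar G) perms)                            ≡⟨ cong parity reversal ⟩
      parity (count (allSteps (λ p q → not (inE3 G p q))) perms)      ≡⟨ parity-count-allSteps-complement n (inE3 G) ⟨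
      parity (count (allSteps (inE3 G)) perms)                        ∎)
      where
      open ≡-Reasoning
      perms = permutations n

      reversal : count (avoidsE3bar G) perms ≡ count (allSteps (λ p q → not (inE3 G p q))) perms
      reversal = sym (trans (count-reverse (allSteps (λ p q → not (inE3 G p q))))
                            (count-cong perms λ {x} _ → allSteps-reverse (λ p q → not (inE3 G p q)) x))

      containsA≡true : ∀ x → containsA G a b x ≡ true
      containsA≡true x = Equivalence.to T-≡
        (forallE12⁺ G {λ u v → samePair u v a b ∨ contains x u v} (λ uv∈ → Equivalence.from T-∨ (inj₁ (only uv∈))))

      avoiding-split : count (avoidsE3bar G) perms ≡ N-all G + count (allSteps (inE3 G)) perms
      avoiding-split = trans (count-split (avoidsE3bar G) (λ x → contains x a b) perms) (cong₂ _+_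
        (count-cong perms λ {x} _ → sym (trans (N-all-pointwise G ab∈ x)
                                              (cong (λ c → (c ∧ avoidsE3bar G x) ∧ contains x a b) (containsA≡true x))))
        (count-cong perms avoidsE3bar-without-ab))

  Covers : List (Fin n × Fin n) → MixedGraph n → Set
  Covers L G = ∀ {u v} → InE₁₂ G u v → (u , v) ∈ L

  Covers-drop : ∀ G {c d L} → Covers ((c , d) ∷ L) G → ∀ {u v} → InE₁₂ G u v → (u , v) ≢ (c , d) → (u , v) ∈ L
  Covers-drop G cover uv∈ uv≢cd with cover uv∈
  ... | here uv≡cd = contradiction uv≡cd uv≢cd
  ... | there uv∈L = uv∈L

  N-all-even : ∀ L G → Covers L G → ∀ {a b} → InE₁₂ G a b → parity (N-all G) ≡ 0ℙ
  N-all-even []            G cover ab∈ with () ← cover ab∈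
  N-all-even ((c , d) ∷ L) G cover ab∈ with InE₁₂? G c d
  ... | no cd∉ = N-all-even L G (λ uv∈ → Covers-drop G cover uv∈ λ { refl → cd∉ uv∈ }) ab∈
  ... | yes cd∈@(c≢d , _) with any? (λ u → any? (λ v → InE₁₂? (orient G c d c≢d) u v))
  ...   | no none = N-all-single-edge G cd∈ only
    where
    only : ∀ {u v} → InE₁₂ G u v → T (samePair u v c d)
    only {u} {v} uv∈ with samePair u v c d in same
    ... | true  = tt
    ... | false = ⊥-elim (none (u , v , InE₁₂-orient⁺ G c≢d uv∈ (subst T same)))
  ...   | yes (u , v , uv∈⃗) = begin
    parity (N-all G)
      ≡⟨ parity-N-all-orient G cd∈ ⟩
    parity (N-all G⃗) ℙ.+ parity (N-all G⃖)
      ≡⟨ cong₂ ℙ._+_ (N-all-even L G⃗ cover⃗ uv∈⃗) (N-all-even L G⃖ cover⃖ uv∈⃖) ⟩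
    0ℙ ∎
    where
    open ≡-Reasoning
    G⃗ = orient G c d c≢d
    G⃖ = orient G d c (proj₁ (InE₁₂-sym G cd∈))
    cover⃗ : Covers L G⃗
    cover⃗ uv∈ with uv∈G , ¬same ← InE₁₂-orient⁻ G c≢d uv∈ =
      Covers-drop G cover uv∈G λ { refl → ¬same (samePair⁺ {c} {d} {c} {d} (inj₁ (refl , refl))) }
    cover⃖ : Covers L G⃖
    cover⃖ uv∈ with uv∈G , ¬same ← InE₁₂-orient⁻ G (proj₁ (InE₁₂-sym G cd∈)) uv∈ =
      Covers-drop G cover uv∈G λ { refl → ¬same (samePair⁺ {c} {d} {d} {c} (inj₂ (refl , refl))) }
    uv∈⃖ : InE₁₂ G⃖ u v
    uv∈⃖ with uv∈G , ¬same ← InE₁₂-orient⁻ G c≢d uv∈⃗ =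
      InE₁₂-orient⁺ G (proj₁ (InE₁₂-sym G cd∈)) uv∈G (¬same ∘ subst T (∨-comm (u == d ∧ v == c) _))

even⇒2∣ : ∀ k → parity k ≡ 0ℙ → 2 ∣ k
even⇒2∣ zero          _    = divides 0 refl
even⇒2∣ (suc (suc k)) even with divides q k≡q*2 ← even⇒2∣ k even = divides (suc q) (cong (suc ∘ suc) k≡q*2)

-- The hypothesis 2 ≤ n is implied by a ≢ b.
mainTheorem5 : (n : ℕ) → 2 ≤ n → (G : MixedGraph n) →
    (a b : Fin n) → a ≢ b → T (inE12 (kind G a b)) →
    (N-A G a b % 2 ≡ N-=A G a b % 2) × (2 ∣ N-all G)
mainTheorem5 n _ G a b a≢b ab∈ = N-A-parity , 2∣N-all
  where
  everyPair : Covers (cartesianProduct (allFin n) (allFin n)) G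
  everyPair {u} {v} _ = ∈-cartesianProduct⁺ (∈-allFin u) (∈-allFin v)
  2∣N-all : 2 ∣ N-all G
  2∣N-all = even⇒2∣ (N-all G) (N-all-even _ G everyPair (a≢b , ab∈))
  N-A-parity : N-A G a b % 2 ≡ N-=A G a b % 2
  N-A-parity with divides q N-all≡q*2 ← 2∣N-all = begin
    N-A G a b % 2               ≡⟨ cong (_% 2) (N-A≡N-all+N-=A G (a≢b , ab∈)) ⟩
    (N-all G + N-=A G a b) % 2  ≡⟨ cong (λ m → (m + N-=A G a b) % 2) N-all≡q*2 ⟩
    (q * 2 + N-=A G a b) % 2    ≡⟨ cong (_% 2) (+-comm (q * 2) _) ⟩
    (N-=A G a b + q * 2) % 2    ≡⟨ [m+kn]%n≡m%n (N-=A G a b) q 2 ⟩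
    N-=A G a b % 2              ∎
    where open ≡-Reasoning
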